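{- Work in intuitionistic (higher-order) type theory, i.e. the internal logic of an elementary topos. Let $B$ be a set, let $A$ be a finite, complemented, proper subset of $B$, and let $f: A \to B$ be a function. Then $B - \mathrm{Range}(f)$ is inhabited, i.e. there exists an element of $B$ not in the range of $f$.
   Context: Logic is intuitionistic (no law of excluded middle). A set $A$ is finite (Kuratowski-finite) if it belongs to every family $\mathcal{Y}$ of sets that contains $\emptyset$ and satisfies: whenever $Z \in \mathcal{Y}$ and $a \in A$, then $Z \cup \{a\} \in \mathcal{Y}$. A set is inhabited if there exists an element in it. A subset $A \subseteq B$ is proper if $B - A$ is inhabited. A subset $A \subseteq B$ is complemented in $B$ if $B = A \cup (B - A)$, i.e. every element of $B$ is either in $A$ or not in $A$. -}

module Defs where

open import Data.Empty using (⊥)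
open import Data.Product using (Σ; ∃; _×_)
open import Data.Sum using (_⊎_)
open import Relation.Nullary using (¬_)
open import Relation.Binary.PropositionalEquality using (_≡_)

Subset : Set → Set₁
Subset B = B → Set

-- A subset is a proposition (subsets in higher-order logic are prop-valued).
IsPropSubset : {B : Set} → Subset B → Set
IsPropSubset {B} A = ∀ (x : B) (p q : A x) → p ≡ q

_≐_ : {B : Set} → Subset B → Subset B → Set
_≐_ {B} Z W = ∀ (x : B) → (Z x → W x) × (W x → Z x)

∅ : {B : Set} → Subset B
∅ _ = ⊥

_∪⟨_⟩ : {B : Set} → Subset B → B → Subset B
(Z ∪⟨ a ⟩) x = Z x ⊎ x ≡ a

-- Kuratowski finiteness: A belongs to every family Y of sets (respecting
-- extensional equality of sets, since sets are extensional) that contains ∅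
-- and is closed under Z ↦ Z ∪ {a} for a ∈ A.
KFinite : {B : Set} → Subset B → Set₁
KFinite {B} A =
  (Y : Subset B → Set) →
  (∀ Z W → Z ≐ W → Y Z → Y W) →
  Y ∅ →
  (∀ Z (a : B) → Y Z → A a → Y (Z ∪⟨ a ⟩)) →
  Y A

Complemented : {B : Set} → Subset B → Set
Complemented {B} A = ∀ (b : B) → A b ⊎ ¬ A b

Proper : {B : Set} → Subset B → Set
Proper {B} A = Σ B (λ b → ¬ A b)

InRange : {B : Set} {A : Subset B} → (Σ B A → B) → B → Set
InRange {B} {A} f b = ∃ (λ (x : Σ B A) → f x ≡ b)

module Submission where

-- Complementedness makes A decidable, and Kuratowski finiteness gives a list
-- covering A, so we may descend on its length.  No equality on B is decided:
-- we only ever ask whether a point, or its image, lies in A.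

open import Defs
open import Data.Product using (Σ; ∃; _×_; _,_; proj₁; proj₂)
open import Data.Sum using (inj₁; inj₂)
open import Data.Nat using (ℕ; suc; _≤_; _<_; s≤s)
open import Data.Nat.Properties using (≤-refl; ≤-trans)
open import Data.List using (List; []; _∷_; length; filter)
open import Data.List.Properties using (filter-notAll)
open import Data.List.Membership.Propositional using (_∈_; lose)
open import Data.List.Membership.Propositional.Properties using (∈-filter⁺)
open import Data.List.Relation.Unary.Any as Any using (here; there; any?)
open import Data.Empty using (⊥-elim)
open import Data.Unit using (tt)
open import Function using (_∘_)
open import Relation.Nullary using (¬_; yes; no)
open import Relation.Nullary.Decidable using (fromSum)
open import Relation.Unary using (Decidable; U; _∩_; _⊢_; ∁; _⊆_)
open import Relation.Unary.Properties using (_∩?_; ∁?)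
open import Relation.Binary.PropositionalEquality using (_≡_; _≢_; refl; subst; sym; trans; cong)

Covers : {B : Set} → List B → Subset B → Set
Covers l A = A ⊆ (_∈ l)

KFinite⇒covered : {B : Set} {A : Subset B} → KFinite A → ∃ λ l → Covers l A
KFinite⇒covered {B} {A} A-finite = A-finite Covered respects ([] , λ ()) insert
  where
  Covered : Subset B → Set
  Covered Z = ∃ λ l → Covers l Z
  respects : ∀ Z W → Z ≐ W → Covered Z → Covered W
  respects Z W Z≐W (l , cover) = l , cover ∘ proj₂ (Z≐W _)
  insert : ∀ Z a → Covered Z → A a → Covered (Z ∪⟨ a ⟩)
  insert Z a (l , cover) _ = a ∷ l , λ { (inj₁ x∈Z) → there (cover x∈Z) ; (inj₂ refl) → here refl }

Complemented⇒Decidable : {B : Set} {A : Subset B} → Complemented A → Decidable A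
Complemented⇒Decidable A-comp = fromSum ∘ A-comp

-- If f maps A into A, the given point of C − A is missed.  Otherwise some
-- a ∈ A is sent outside A, and we recurse with the strictly smaller
-- A ∩ f⁻¹(A) inside A and a as the point outside it: a point of A missed by f
-- on A ∩ f⁻¹(A) is missed on all of A, since f x ∈ A forces x ∈ f⁻¹(A).
∃-outside-image : {B : Set} (n : ℕ) {A C : Subset B} → Decidable A → A ⊆ C →
  (f : B → B) → (l : List B) → length l ≤ n → Covers l A →
  ∃ (C ∩ ∁ A) → ∃ λ b → C b × (∀ {x} → A x → f x ≢ b)
∃-outside-image n {A} {C} A? A⊆C f l |l|≤n cover (b₀ , Cb₀ , b₀∉A)
  with any? (A? ∩? ∁? (A? ∘ f)) l
... | no ¬escape = b₀ , Cb₀ , λ x∈A fx≡b₀ →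
  ¬escape (lose (cover x∈A) (x∈A , subst (∁ A) (sym fx≡b₀) b₀∉A))
... | yes escape = descend n (≤-trans shorter |l|≤n)
  where
  A′? : Decidable (A ∩ (f ⊢ A))
  A′? = A? ∩? (A? ∘ f)
  l′ = filter A′? l
  shorter : length l′ < length l
  shorter = filter-notAll A′? l (Any.map (λ (_ , fx∉A) → fx∉A ∘ proj₂) escape)
  a∈A∖A′ : ∃ (A ∩ ∁ (A ∩ (f ⊢ A)))
  a∈A∖A′ with a , a∈A , fa∉A ← Any.satisfied escape = a , a∈A , fa∉A ∘ proj₂
  descend : (n : ℕ) → length l′ < n → ∃ λ b → C b × (∀ {x} → A x → f x ≢ b)
  descend (suc m) (s≤s |l′|≤m)
    with b , b∈A , missed ← ∃-outside-image m A′? proj₁ f l′ |l′|≤m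
      (λ x∈A′ → ∈-filter⁺ A′? (cover (proj₁ x∈A′)) x∈A′) a∈A∖A′
    = b , A⊆C b∈A , λ x∈A fx≡b → missed (x∈A , subst A (sym fx≡b) b∈A) fx≡b

extend : {B : Set} {A : Subset B} → Complemented A → (Σ B A → B) → B → B
extend A-comp f x with A-comp x
... | inj₁ x∈A = f (x , x∈A)
... | inj₂ _ = x

extend-agrees : {B : Set} {A : Subset B} → IsPropSubset A → (A-comp : Complemented A) →
  (f : Σ B A → B) → ∀ {x} (x∈A : A x) → extend A-comp f x ≡ f (x , x∈A)
extend-agrees A-prop A-comp f {x} x∈A with A-comp x
... | inj₁ x∈A′ = cong (f ∘ (x ,_)) (A-prop x x∈A′ x∈A)
... | inj₂ x∉A = ⊥-elim (x∉A x∈A)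

theorem2 : (B : Set) (A : Subset B) → IsPropSubset A →
    KFinite A → Complemented A → Proper A →
    (f : Σ B A → B) →
    Σ B (λ b → ¬ InRange f b)
theorem2 B A A-prop A-finite A-comp (b₀ , b₀∉A) f
  with l , cover ← KFinite⇒covered A-finite
  with b , _ , missed ← ∃-outside-image (length l) {C = U} (Complemented⇒Decidable A-comp) _
         (extend A-comp f) l ≤-refl cover (b₀ , tt , b₀∉A)
  = b , λ ((x , x∈A) , fx≡b) → missed x∈A (trans (extend-agrees A-prop A-comp f x∈A) fx≡b)
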